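{- For $n\in\{2,3\}$, $\theta^{c}(\mathcal{K}_{n,n,n})>2n$, where $\mathcal{K}_{n,n,n}$ is the complete tripartite graph with three parts of size $n$.
   Context: Graphs are finite, simple and undirected. For a graph $\mathcal{G}=(\mathcal{V},\mathcal{E})$ and positive integers $\alpha,\beta$, an $(\alpha\mid\beta)$-cointersection representation (CIR) of $\mathcal{G}$ consists of two disjoint finite sets of features $\mathcal{A},\mathcal{B}$ with $|\mathcal{A}|=\alpha$, $|\mathcal{B}|=\beta$, together with an assignment to each vertex $v$ of subsets $A_v\subseteq\mathcal{A}$, $B_v\subseteq\mathcal{B}$ (possibly empty), such that for all distinct $u,v\in\mathcal{V}$: $(u,v)\in\mathcal{E}$ if and only if $A_u\cap A_v\neq\varnothing$ and $B_u\cap B_v\neq\varnothing$. The cointersection number $\theta^{c}(\mathcal{G})$ is the minimum of $\alpha+\beta$ over all CIRs of $\mathcal{G}$. -}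

module Defs where

open import Data.Nat using (ℕ; _+_; _*_; _<_)
open import Data.Fin using (Fin; quotRem)
open import Data.Fin.Subset using (Subset; _∩_; Nonempty)
open import Data.Product using (_×_; proj₂)
open import Relation.Binary.PropositionalEquality using (_≡_; refl) renaming (sym to ≡-sym)
open import Relation.Nullary using (¬_)
open import Function.Bundles using (_⇔_)
open import Level using (0ℓ)

record Graph (k : ℕ) : Set₁ where
  field
    Adj   : Fin k → Fin k → Set
    sym   : ∀ {u v} → Adj u v → Adj v u
    irrefl : ∀ {u} → ¬ Adj u u

open Graph public

-- (α | β)-cointersection representation of G.
-- Feature sets 𝒜 = Fin α, ℬ = Fin β (disjoint by construction),
-- A v ⊆ 𝒜, B v ⊆ ℬ, and for distinct u v:
-- adjacent iff A u ∩ A v ≠ ∅ and B u ∩ B v ≠ ∅.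
record CIR {k : ℕ} (G : Graph k) (α β : ℕ) : Set where
  field
    A   : Fin k → Subset α
    B   : Fin k → Subset β
    rep : ∀ u v → ¬ u ≡ v →
          (Adj G u v ⇔ (Nonempty (A u ∩ A v) × Nonempty (B u ∩ B v)))

-- θᶜ(G) > m : every CIR of G uses more than m features in total
-- (θᶜ is the minimum of α + β over all CIRs, and CIRs always exist).
θᶜ>_ : ∀ {k} → ℕ → Graph k → Set
(θᶜ> m) G = ∀ α β → CIR G α β → m < α + β

-- Complete tripartite graph K_{n,n,n} on vertex set Fin (3 * n):
-- vertex v lies in part (v div n) ∈ Fin 3, each part has exactly n vertices;
-- two vertices are adjacent iff they lie in different parts.
part : (n : ℕ) → Fin (3 * n) → Fin 3
part n v = proj₂ (quotRem {3} n v)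

K₃ : (n : ℕ) → Graph (3 * n)
K₃ n = record
  { Adj = λ u v → ¬ part n u ≡ part n v
  ; sym = λ p q → p (≡-sym q)
  ; irrefl = λ p → p refl
  }

module Submission where

-- Fix an (α ∣ β)-CIR of K_{n,n,n}.  Two distinct vertices of the same
-- part are non-adjacent, so their A-sets or their B-sets are disjoint: this
-- 2-colours the pairs inside each part.  For n = 2, 3 such a colouring always has an
-- "A-clique" of size a and a "B-clique" of size b with a + b = n + 1 (a tiny Ramsey
-- fact).  Vertices of different parts are adjacent, so their A-sets meet and their
-- B-sets meet; and k pairwise-disjoint sets each meeting all of m other
-- pairwise-disjoint sets force k * m distinct features.  Hence α ≥ a_P * a_Q and
-- β ≥ b_P * b_Q for any two parts P ≠ Q, and a finite check over the possible
-- clique sizes shows these bounds sum to more than 2n.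

open import Defs
open import Data.Nat using (ℕ; _*_; _+_; _∸_; _≤_; _<_; _⊔_; _<?_; suc)
open import Data.Nat.Properties using (⊔-lub; +-mono-≤; module ≤-Reasoning)
open import Data.Sum using (_⊎_; inj₁; inj₂)
open import Data.Product using (_×_; _,_; proj₁; proj₂; uncurry; swap)
open import Data.Fin using (Fin; zero; suc; toℕ; remQuot; combine; #_)
open import Data.Fin.Properties
  using (injective⇒≤; combine-remQuot; remQuot-combine; combine-injective; _≟_; all?)
open import Data.Fin.Subset using (Subset; _∩_; _∈_; Nonempty; Empty)
open import Data.Fin.Subset.Properties using (nonempty?; x∈p∩q⁺; x∈p∩q⁻)
open import Data.Vec.Functional using ([]; _∷_)
open import Data.Empty using (⊥-elim)
open import Function using (_∘_)
open import Function.Bundles using (Equivalence)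
open import Relation.Binary.PropositionalEquality
  using (_≡_; _≢_; refl; cong; subst; trans; module ≡-Reasoning) renaming (sym to ≡-sym)
open import Relation.Binary.Core using (Rel)
open import Relation.Binary.Definitions using (Symmetric)
open import Level using (0ℓ)
open import Relation.Nullary using (¬_; yes; no)
open import Relation.Nullary.Decidable using (toWitness)

Clique : ∀ {k} {X : Set} → Rel X 0ℓ → (Fin k → X) → Set
Clique R f = ∀ i j → i ≢ j → R (f i) (f j)

Disjoint : ∀ {d} → Rel (Subset d) 0ℓ
Disjoint p q = Empty (p ∩ q)

Disjoint-sym : ∀ {d} → Symmetric (Disjoint {d})
Disjoint-sym p∩q=∅ (f , f∈q∩p) = p∩q=∅ (f , x∈p∩q⁺ (swap (x∈p∩q⁻ _ _ f∈q∩p)))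

common-element : ∀ {d} {p q : Subset d} {f : Fin d} → f ∈ p → f ∈ q → Nonempty (p ∩ q)
common-element f∈p f∈q = _ , x∈p∩q⁺ (f∈p , f∈q)

remQuot-injective : ∀ {k} m {x y : Fin (k * m)} → remQuot {k} m x ≡ remQuot m y → x ≡ y
remQuot-injective {k} m {x} {y} e = begin
  x                                   ≡⟨ ≡-sym (combine-remQuot {k} m x) ⟩
  uncurry combine (remQuot {k} m x)   ≡⟨ cong (uncurry combine) e ⟩
  uncurry combine (remQuot {k} m y)   ≡⟨ combine-remQuot {k} m y ⟩
  y                                   ∎
  where open ≡-Reasoning

-- A chosen point of Fᵢ ∩ Gⱼ determines both i and j, giving an injection.
cross-intersecting-bound : ∀ {k m d} (F : Fin k → Subset d) (G : Fin m → Subset d) →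
  Clique Disjoint F → Clique Disjoint G → (∀ i j → Nonempty (F i ∩ G j)) → k * m ≤ d
cross-intersecting-bound {k} {m} {d} F G F-disjoint G-disjoint meet =
  injective⇒≤ {f = uncurry witness ∘ remQuot {k} m} (remQuot-injective {k} m ∘ witness-injective _ _)
  where
  witness : Fin k → Fin m → Fin d
  witness i j = proj₁ (meet i j)

  witness∈ : ∀ i j → witness i j ∈ F i × witness i j ∈ G j
  witness∈ i j = x∈p∩q⁻ (F i) (G j) (proj₂ (meet i j))

  witness-injective : ∀ p q → uncurry witness p ≡ uncurry witness q → p ≡ q
  witness-injective (i , j) (i′ , j′) e with i ≟ i′ | j ≟ j′
  ... | yes refl | yes refl = refl
  ... | no i≢i′ | _ = ⊥-elim (F-disjoint i i′ i≢i′
        (common-element (proj₁ (witness∈ i j)) (subst (_∈ F i′) (≡-sym e) (proj₁ (witness∈ i′ j′)))))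
  ... | yes refl | no j≢j′ = ⊥-elim (G-disjoint j j′ j≢j′
        (common-element (proj₂ (witness∈ i j)) (subst (_∈ G j′) (≡-sym e) (proj₂ (witness∈ i′ j′)))))

module CIR-Facts {k α β} {G : Graph k} (c : CIR G α β) where
  open CIR c

  adjacent-meet : ∀ {u v} → Adj G u v → Nonempty (A u ∩ A v) × Nonempty (B u ∩ B v)
  adjacent-meet {u} {v} uv = Equivalence.to (rep u v u≢v) uv
    where
    u≢v : u ≢ v
    u≢v refl = irrefl G uv

  nonadjacent-separated : ∀ {u v} → u ≢ v → ¬ Adj G u v →
    Disjoint (A u) (A v) ⊎ Disjoint (B u) (B v)
  nonadjacent-separated {u} {v} u≢v ¬uv with nonempty? (A u ∩ A v)
  ... | no  A-disjoint = inj₁ A-disjoint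
  ... | yes A-meet     = inj₂ (λ B-meet → ¬uv (Equivalence.from (rep u v u≢v) (A-meet , B-meet)))

  biclique-bound-A : ∀ {a b} (x : Fin a → Fin k) (y : Fin b → Fin k) →
    Clique Disjoint (A ∘ x) → Clique Disjoint (A ∘ y) → (∀ i j → Adj G (x i) (y j)) → a * b ≤ α
  biclique-bound-A x y x-disjoint y-disjoint adj =
    cross-intersecting-bound (A ∘ x) (A ∘ y) x-disjoint y-disjoint
                             (λ i j → proj₁ (adjacent-meet (adj i j)))

  biclique-bound-B : ∀ {a b} (x : Fin a → Fin k) (y : Fin b → Fin k) →
    Clique Disjoint (B ∘ x) → Clique Disjoint (B ∘ y) → (∀ i j → Adj G (x i) (y j)) → a * b ≤ β
  biclique-bound-B x y x-disjoint y-disjoint adj =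
    cross-intersecting-bound (B ∘ x) (B ∘ y) x-disjoint y-disjoint
                             (λ i j → proj₂ (adjacent-meet (adj i j)))

-- Clique sizes attached to a shape s : Fin n: a red clique of size s + 1 and a blue
-- clique of size n - s, so the two sizes always add up to n + 1.
redSize : ∀ {n} → Fin n → ℕ
redSize s = suc (toℕ s)

blueSize : ∀ n → Fin n → ℕ
blueSize n s = n ∸ toℕ s

record RedBlueCliques {n} (Red Blue : Rel (Fin n) 0ℓ) : Set where
  field
    shape       : Fin n
    red         : Fin (redSize shape) → Fin n
    red-clique  : Clique Red red
    blue        : Fin (blueSize n shape) → Fin n
    blue-clique : Clique Blue blue

open RedBlueCliques

clique₁ : ∀ {X : Set} (R : Rel X 0ℓ) (x : X) → Clique R (x ∷ [])
clique₁ R x zero zero 0≢0 = ⊥-elim (0≢0 refl)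

clique₂ : ∀ {X : Set} (R : Rel X 0ℓ) → Symmetric R → ∀ {x y} → R x y → Clique R (x ∷ y ∷ [])
clique₂ R sym xy zero       zero       ne = ⊥-elim (ne refl)
clique₂ R sym xy zero       (suc zero) _  = xy
clique₂ R sym xy (suc zero) zero       _  = sym xy
clique₂ R sym xy (suc zero) (suc zero) ne = ⊥-elim (ne refl)

clique₃ : ∀ {X : Set} (R : Rel X 0ℓ) → Symmetric R → ∀ {x y z} →
  R x y → R x z → R y z → Clique R (x ∷ y ∷ z ∷ [])
clique₃ R sym xy xz yz zero             zero             ne = ⊥-elim (ne refl)
clique₃ R sym xy xz yz zero             (suc zero)       _  = xy
clique₃ R sym xy xz yz zero             (suc (suc zero)) _  = xz
clique₃ R sym xy xz yz (suc zero)       zero             _  = sym xy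
clique₃ R sym xy xz yz (suc zero)       (suc zero)       ne = ⊥-elim (ne refl)
clique₃ R sym xy xz yz (suc zero)       (suc (suc zero)) _  = yz
clique₃ R sym xy xz yz (suc (suc zero)) zero             _  = sym xz
clique₃ R sym xy xz yz (suc (suc zero)) (suc zero)       _  = sym yz
clique₃ R sym xy xz yz (suc (suc zero)) (suc (suc zero)) ne = ⊥-elim (ne refl)

TwoColouring : ∀ {n} → Rel (Fin n) 0ℓ → Rel (Fin n) 0ℓ → Set
TwoColouring Red Blue = ∀ t t′ → t ≢ t′ → Red t t′ ⊎ Blue t t′

-- On three points, a red edge and a blue edge are cliques of sizes 2 + 2 = 3 + 1.
red-and-blue-edge : (Red Blue : Rel (Fin 3) 0ℓ) → Symmetric Red → Symmetric Blue →
  ∀ {x y x′ y′} → Red x y → Blue x′ y′ → RedBlueCliques Red Blue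
red-and-blue-edge Red Blue symR symB {x} {y} {x′} {y′} r b =
  record { shape = # 1 ; red  = x ∷ y ∷ []   ; red-clique  = clique₂ Red symR r
                       ; blue = x′ ∷ y′ ∷ [] ; blue-clique = clique₂ Blue symB b }

red-blue-cliques : ∀ {n} → n ≡ 2 ⊎ n ≡ 3 → (Red Blue : Rel (Fin n) 0ℓ) →
  Symmetric Red → Symmetric Blue → TwoColouring Red Blue → RedBlueCliques Red Blue
red-blue-cliques (inj₁ refl) Red Blue symR symB colour with colour (# 0) (# 1) (λ ())
... | inj₁ r01 = record { shape = # 1 ; red  = # 0 ∷ # 1 ∷ [] ; red-clique  = clique₂ Red symR r01
                                      ; blue = # 0 ∷ []       ; blue-clique = clique₁ Blue (# 0) }
... | inj₂ b01 = record { shape = # 0 ; red  = # 0 ∷ []       ; red-clique  = clique₁ Red (# 0)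
                                      ; blue = # 0 ∷ # 1 ∷ [] ; blue-clique = clique₂ Blue symB b01 }
red-blue-cliques (inj₂ refl) Red Blue symR symB colour
  with colour (# 0) (# 1) (λ ()) | colour (# 0) (# 2) (λ ()) | colour (# 1) (# 2) (λ ())
... | inj₁ r01 | inj₁ r02 | inj₁ r12 =
  record { shape = # 2 ; red  = # 0 ∷ # 1 ∷ # 2 ∷ [] ; red-clique  = clique₃ Red symR r01 r02 r12
                       ; blue = # 0 ∷ []             ; blue-clique = clique₁ Blue (# 0) }
... | inj₂ b01 | inj₂ b02 | inj₂ b12 =
  record { shape = # 0 ; red  = # 0 ∷ []             ; red-clique  = clique₁ Red (# 0)
                       ; blue = # 0 ∷ # 1 ∷ # 2 ∷ [] ; blue-clique = clique₃ Blue symB b01 b02 b12 }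
... | inj₁ r01 | inj₁ _   | inj₂ b12 = red-and-blue-edge Red Blue symR symB r01 b12
... | inj₁ r01 | inj₂ b02 | _        = red-and-blue-edge Red Blue symR symB r01 b02
... | inj₂ b01 | inj₁ r02 | _        = red-and-blue-edge Red Blue symR symB r02 b01
... | inj₂ b01 | inj₂ _   | inj₁ r12 = red-and-blue-edge Red Blue symR symB r12 b01

maxPairProduct : ℕ → ℕ → ℕ → ℕ
maxPairProduct a b c = a * b ⊔ a * c ⊔ b * c

maxPairProduct-lub : ∀ a b c {d} → a * b ≤ d → a * c ≤ d → b * c ≤ d → maxPairProduct a b c ≤ d
maxPairProduct-lub a b c ab ac bc = ⊔-lub (⊔-lub ab ac) bc

redCost : ∀ {n} → Fin n → Fin n → Fin n → ℕ
redCost s₀ s₁ s₂ = maxPairProduct (redSize s₀) (redSize s₁) (redSize s₂)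

blueCost : ∀ n → Fin n → Fin n → Fin n → ℕ
blueCost n s₀ s₁ s₂ = maxPairProduct (blueSize n s₀) (blueSize n s₁) (blueSize n s₂)

cost : ∀ n → Fin n → Fin n → Fin n → ℕ
cost n s₀ s₁ s₂ = redCost s₀ s₁ s₂ + blueCost n s₀ s₁ s₂

cost-exceeds : ∀ {n} → n ≡ 2 ⊎ n ≡ 3 → ∀ s₀ s₁ s₂ → 2 * n < cost n s₀ s₁ s₂
cost-exceeds (inj₁ refl) =
  toWitness {a? = all? λ s₀ → all? λ s₁ → all? λ s₂ → 2 * 2 <? cost 2 s₀ s₁ s₂} _
cost-exceeds (inj₂ refl) =
  toWitness {a? = all? λ s₀ → all? λ s₁ → all? λ s₂ → 2 * 3 <? cost 3 s₀ s₁ s₂} _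

-- The vertices of K_{n,n,n}: the t-th vertex of part P is combine P t.
part-combine : ∀ n (P : Fin 3) (t : Fin n) → part n (combine P t) ≡ P
part-combine n P t = cong proj₁ (remQuot-combine P t)

module Tripartite (n : ℕ) {α β} (c : CIR (K₃ n) α β) where
  open CIR c
  open CIR-Facts c

  cross-adjacent : ∀ {P Q} → P ≢ Q → ∀ t t′ → Adj (K₃ n) (combine P t) (combine Q t′)
  cross-adjacent {P} {Q} P≢Q t t′ rewrite part-combine n P t | part-combine n Q t′ = P≢Q

  same-part-nonadjacent : ∀ P t t′ → ¬ Adj (K₃ n) (combine P t) (combine P t′)
  same-part-nonadjacent P t t′ ¬same = ¬same (trans (part-combine n P t) (≡-sym (part-combine n P t′)))

  -- The colouring of part P: two of its vertices are red (blue) when their A-sets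
  -- (B-sets) are disjoint.
  SeparatedA SeparatedB : Fin 3 → Rel (Fin n) 0ℓ
  SeparatedA P t t′ = Disjoint (A (combine P t)) (A (combine P t′))
  SeparatedB P t t′ = Disjoint (B (combine P t)) (B (combine P t′))

  part-colouring : ∀ P → TwoColouring (SeparatedA P) (SeparatedB P)
  part-colouring P t t′ t≢t′ = nonadjacent-separated distinct (same-part-nonadjacent P t t′)
    where
    distinct : combine P t ≢ combine P t′
    distinct e = t≢t′ (proj₂ (combine-injective P t P t′ e))

  PartSplit : Fin 3 → Set
  PartSplit P = RedBlueCliques (SeparatedA P) (SeparatedB P)

  split-part : n ≡ 2 ⊎ n ≡ 3 → ∀ P → PartSplit P
  split-part small P =
    red-blue-cliques small (SeparatedA P) (SeparatedB P) Disjoint-sym Disjoint-sym (part-colouring P)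

  split-bound-A : ∀ P Q → P ≢ Q → (S : PartSplit P) (T : PartSplit Q) →
    redSize (shape S) * redSize (shape T) ≤ α
  split-bound-A P Q P≢Q S T =
    biclique-bound-A (combine P ∘ red S) (combine Q ∘ red T) (red-clique S) (red-clique T)
                     (λ i j → cross-adjacent P≢Q (red S i) (red T j))

  split-bound-B : ∀ P Q → P ≢ Q → (S : PartSplit P) (T : PartSplit Q) →
    blueSize n (shape S) * blueSize n (shape T) ≤ β
  split-bound-B P Q P≢Q S T =
    biclique-bound-B (combine P ∘ blue S) (combine Q ∘ blue T) (blue-clique S) (blue-clique T)
                     (λ i j → cross-adjacent P≢Q (blue S i) (blue T j))

  module _ (S₀ : PartSplit (# 0)) (S₁ : PartSplit (# 1)) (S₂ : PartSplit (# 2)) where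

    redCost-bound : redCost (shape S₀) (shape S₁) (shape S₂) ≤ α
    redCost-bound = maxPairProduct-lub (redSize (shape S₀)) (redSize (shape S₁)) (redSize (shape S₂))
                                       (split-bound-A (# 0) (# 1) (λ ()) S₀ S₁)
                                       (split-bound-A (# 0) (# 2) (λ ()) S₀ S₂)
                                       (split-bound-A (# 1) (# 2) (λ ()) S₁ S₂)

    blueCost-bound : blueCost n (shape S₀) (shape S₁) (shape S₂) ≤ β
    blueCost-bound = maxPairProduct-lub (blueSize n (shape S₀)) (blueSize n (shape S₁)) (blueSize n (shape S₂))
                                        (split-bound-B (# 0) (# 1) (λ ()) S₀ S₁)
                                        (split-bound-B (# 0) (# 2) (λ ()) S₀ S₂)
                                        (split-bound-B (# 1) (# 2) (λ ()) S₁ S₂)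

    cost-bound : cost n (shape S₀) (shape S₁) (shape S₂) ≤ α + β
    cost-bound = +-mono-≤ redCost-bound blueCost-bound

proposition4 : ∀ (n : ℕ) → (n ≡ 2 ⊎ n ≡ 3) → (θᶜ> (2 * n)) (K₃ n)
proposition4 n small α β c = begin-strict
  2 * n                                   <⟨ cost-exceeds small (shape S₀) (shape S₁) (shape S₂) ⟩
  cost n (shape S₀) (shape S₁) (shape S₂) ≤⟨ cost-bound S₀ S₁ S₂ ⟩
  α + β                                   ∎
  where
  open ≤-Reasoning
  open Tripartite n c
  S₀ : PartSplit (# 0)
  S₀ = split-part small (# 0)
  S₁ : PartSplit (# 1)
  S₁ = split-part small (# 1)
  S₂ : PartSplit (# 2)
  S₂ = split-part small (# 2)
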